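{- Let $w\in S_n$. For every saturated chain $C$ in the Bruhat interval $[\mathrm{id},w]$ from $\mathrm{id}$ to $w$, \[\mathrm{supp}(m_C)\subseteq\mathrm{supp}(\mathrm{GW}(w)),\qquad\text{where }\ \mathrm{GW}(w)=\prod_{(a,b)\in\mathrm{Inv}(w)}(x_a+x_{a+1}+\dots+x_{b-1}).\]
   Context: $S_n$ is the symmetric group on $[n]$; $\mathrm{Inv}(w)$ is the set of pairs $(a,b)$, $a<b$, with $w(a)>w(b)$, and $\ell(w)=|\mathrm{Inv}(w)|$. For $a<b$, $wt_{ab}$ swaps entries in positions $a,b$. Bruhat covers: $u\lessdot v$ iff $v=ut_{ab}$ ($a<b$) and $\ell(v)=\ell(u)+1$. Edge weight $m(u\lessdot ut_{ab})=x_a+\dots+x_{b-1}$; a saturated chain $C=(u_0\lessdot\cdots\lessdot u_\ell)$ has weight $m_C=\prod_i m(u_{i-1}\lessdot u_i)$. The support of a polynomial is the set of exponent vectors with nonzero coefficient. -}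

module Defs where

open import Data.Nat as ℕ using (ℕ; zero; suc; _+_; _*_)
open import Data.Fin as Fin using (Fin; toℕ)
open import Data.Fin.Permutation using (Permutation′; _⟨$⟩ʳ_; transpose; _∘ₚ_; id)
open import Data.List as List using (List; []; _∷_; filter; concatMap; map; foldr; allFin; length)
open import Data.Vec as Vec using (Vec)
open import Data.Vec.Properties using (≡-dec)
open import Data.Product using (_×_; _,_; proj₁; proj₂)
open import Relation.Nullary using (yes; no)
open import Relation.Binary.PropositionalEquality using (_≡_)

-- Permutations of [n] (positions and values indexed by Fin n, i.e. 0-based)
Perm : ℕ → Set
Perm n = Permutation′ n

Inv : ∀ {n} → Perm n → List (Fin n × Fin n)
Inv {n} w = filter (λ p → (w ⟨$⟩ʳ proj₂ p) Fin.<? (w ⟨$⟩ʳ proj₁ p))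
              (filter (λ p → proj₁ p Fin.<? proj₂ p)
                 (concatMap (λ a → map (a ,_) (allFin n)) (allFin n)))

ℓ : ∀ {n} → Perm n → ℕ
ℓ w = length (Inv w)

-- u t_{ab}: (u t_{ab})(i) = u(t_{ab}(i)), i.e. entries in positions a, b swapped
_·t[_,_] : ∀ {n} → Perm n → Fin n → Fin n → Perm n
u ·t[ a , b ] = transpose a b ∘ₚ u

-- Polynomials in x_0 … x_{n-1} with natural-number coefficients,
-- represented as formal sums of terms (coefficient , exponent vector).

Monomial : ℕ → Set
Monomial n = Vec ℕ n

Poly : ℕ → Set
Poly n = List (ℕ × Monomial n)

coeff : ∀ {n} → Poly n → Monomial n → ℕ
coeff [] e = 0
coeff ((c , e′) ∷ p) e with ≡-dec ℕ._≟_ e′ e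
... | yes _ = c + coeff p e
... | no  _ = coeff p e

_∈supp_ : ∀ {n} → Monomial n → Poly n → Set
e ∈supp p = coeff p e ≡ 0 → Data.Empty.⊥
  where import Data.Empty

_⊆supp_ : ∀ {n} → Poly n → Poly n → Set
p ⊆supp q = ∀ e → e ∈supp p → e ∈supp q

1ₚ : ∀ {n} → Poly n
1ₚ = (1 , Vec.replicate _ 0) ∷ []

_*ₚ_ : ∀ {n} → Poly n → Poly n → Poly n
p *ₚ q = concatMap (λ s → map (λ t → (proj₁ s * proj₁ t , Vec.zipWith _+_ (proj₂ s) (proj₂ t))) q) p

var : ∀ {n} → Fin n → Poly n
var {n} i = (1 , Vec.updateAt (Vec.replicate n 0) i (λ _ → 1)) ∷ []

lin : ∀ {n} → Fin n → Fin n → Poly n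
lin {n} a b = concatMap var
  (filter (λ i → toℕ a ℕ.≤? toℕ i) (filter (λ i → toℕ i ℕ.<? toℕ b) (allFin n)))

prodₚ : ∀ {n} → List (Poly n) → Poly n
prodₚ = foldr _*ₚ_ 1ₚ

GW : ∀ {n} → Perm n → Poly n
GW w = prodₚ (map (λ p → lin (proj₁ p) (proj₂ p)) (Inv w))

-- Saturated chains u = u_0 ⋖ u_1 ⋖ ⋯ ⋖ u_k with u_k pointwise equal to v.
-- Each step is a Bruhat cover u ⋖ u t_{ab} (a < b, ℓ(u t_{ab}) = ℓ(u) + 1).

data SatChain {n} : Perm n → Perm n → Set where
  done : ∀ {u v} → (∀ i → u ⟨$⟩ʳ i ≡ v ⟨$⟩ʳ i) → SatChain u v
  step : ∀ {u v} (a b : Fin n) → a Fin.< b → ℓ (u ·t[ a , b ]) ≡ suc (ℓ u) →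
         SatChain (u ·t[ a , b ]) v → SatChain u v

-- weight m_C = product of edge weights m(u ⋖ u t_{ab}) = x_a + … + x_{b-1}
weight : ∀ {n} {u v : Perm n} → SatChain u v → Poly n
weight (done _) = 1ₚ
weight (step a b _ _ C) = lin a b *ₚ weight C

-- Coefficients are natural numbers, so nothing cancels: the support of a product of
-- interval sums x_a + ⋯ + x_{b-1} consists of the exponent vectors obtained by picking one
-- variable from each factor.  Let u ⋖ w = u t_{ab}, so u(a) < u(b).  Keep (a , b) and every
-- inversion of u that is still an inversion of w; the other inversions of u are the (b , d)
-- and (c , a) with u(d), u(c) between u(a) and u(b), and swapping a and b in them gives
-- inversions (a , d), (c , b) of w.  This injects {(a , b)} ∪ Inv(u) into Inv(w), only
-- enlarging intervals, and is a bijection because ℓ(w) = ℓ(u) + 1; so every such choice for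
-- m(u ⋖ w) · GW(u) is a choice for GW(w).  Induction along the chain, starting from
-- GW(id) = 1, gives the claim.  The same injection for u t_{ab} shows that ℓ would drop
-- if u(a) > u(b), so covers do satisfy u(a) < u(b).

{-# OPTIONS --safe #-}
module Submission where

open import Defs
open import Algebra.Bundles using (CommutativeSemigroup)
import Algebra.Properties.CommutativeSemigroup as CommutativeSemigroupProperties
open import Data.Bool using (if_then_else_)
open import Data.Fin using (Fin; toℕ; _≤_; _<_; _<?_)
open import Data.Fin.Properties
  using (_≟_; <⇒≢; <-irrefl; <-asym; <-trans; <-cmp; ≤-reflexive; ≤∧≢⇒<)
open import Data.Fin.Permutation using (_⟨$⟩ʳ_; _≈_; id)
import Data.Fin.Permutation.Components as PC
open import Data.List
  using (List; []; _∷_; _++_; map; filter; concatMap; allFin; length; cartesianProduct)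
open import Data.List.Membership.Propositional using (_∈_; _∉_; find; lose)
open import Data.List.Membership.Propositional.Properties
  using ( ∈-map⁺; ∈-map⁻; ∈-concatMap⁺; ∈-concatMap⁻; ∈-filter⁺; ∈-filter⁻
        ; ∈-allFin; ∈-cartesianProduct⁺; ∈-∃++; ∈-++⁻; ∈-++⁺ˡ; ∈-++⁺ʳ)
open import Data.List.Properties using (filter-≐; filter-none; length-++; length-map; ++-identityʳ)
open import Data.List.Relation.Unary.Any using (here; there)
open import Data.List.Relation.Unary.All as All using (All)
open import Data.List.Relation.Unary.AllPairs using (_∷_)
open import Data.List.Relation.Unary.Unique.Propositional using (Unique)
import Data.List.Relation.Unary.Unique.Propositional.Properties as Unique
open import Data.List.Relation.Binary.Permutation.Propositional as ↭ using (_↭_; ↭-sym)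
open import Data.List.Relation.Binary.Permutation.Propositional.Properties using (shift; ↭-length)
open import Data.Nat as ℕ using (ℕ; zero; suc; _+_; _*_)
import Data.Nat.Properties as ℕ
open import Data.Product using (_×_; _,_; proj₁; proj₂; ∃-syntax; ∃₂)
open import Data.Sum using (inj₁; inj₂; [_,_]′)
open import Data.Vec as Vec using ()
open import Data.Vec.Properties
  using (≡-dec; zipWith-assoc; zipWith-comm; zipWith-identityˡ; zipWith-identityʳ)
open import Function using (_∘_; Injection)
open import Function.Properties.Inverse using (↔⇒↣)
open import Relation.Binary.Definitions using (tri<; tri≈; tri>)
open import Relation.Binary.PropositionalEquality
open import Relation.Binary.PropositionalEquality.Algebra using (isMagma)
open import Relation.Unary using (Decidable)
open import Relation.Nullary using (¬_; yes; no; does; contradiction)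
open import Relation.Nullary.Decidable using (dec-true; dec-false; toSum)

_⊕_ : ∀ {n} → Monomial n → Monomial n → Monomial n
_⊕_ = Vec.zipWith _+_

0ᵐ : ∀ {n} → Monomial n
0ᵐ = Vec.replicate _ 0

unit : ∀ {n} → Fin n → Monomial n
unit {n} i = Vec.updateAt (Vec.replicate n 0) i (λ _ → 1)

⊕-identityˡ : ∀ {n} (e : Monomial n) → 0ᵐ ⊕ e ≡ e
⊕-identityˡ = zipWith-identityˡ ℕ.+-identityˡ

⊕-identityʳ : ∀ {n} (e : Monomial n) → e ⊕ 0ᵐ ≡ e
⊕-identityʳ = zipWith-identityʳ ℕ.+-identityʳ

⊕-commutativeSemigroup : ℕ → CommutativeSemigroup _ _
⊕-commutativeSemigroup n = record
  { Carrier                = Monomial n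
  ; _≈_                    = _≡_
  ; _∙_                    = _⊕_
  ; isCommutativeSemigroup = record
    { isSemigroup = record { isMagma = isMagma _⊕_ ; assoc = zipWith-assoc ℕ.+-assoc }
    ; comm        = zipWith-comm ℕ.+-comm
    }
  }

module ⊕ {n} = CommutativeSemigroupProperties (⊕-commutativeSemigroup n)

_∈terms_ : ∀ {n} → Monomial n → Poly n → Set
e ∈terms p = ∃[ c ] (c ≢ 0 × (c , e) ∈ p)

∈terms-∷ : ∀ {n} {e} {p : Poly n} {t} → e ∈terms p → e ∈terms (t ∷ p)
∈terms-∷ (c , c≢0 , t∈p) = c , c≢0 , there t∈p

∈supp⇒∈terms : ∀ {n} (p : Poly n) {e} → e ∈supp p → e ∈terms p
∈supp⇒∈terms [] e∈ = contradiction refl e∈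
∈supp⇒∈terms ((c , e′) ∷ p) {e} e∈ with ≡-dec ℕ._≟_ e′ e
∈supp⇒∈terms ((zero , e′) ∷ p)  e∈ | yes refl = ∈terms-∷ (∈supp⇒∈terms p e∈)
∈supp⇒∈terms ((suc c , e′) ∷ p) e∈ | yes refl = suc c , (λ ()) , here refl
∈supp⇒∈terms ((c , e′) ∷ p)     e∈ | no _     = ∈terms-∷ (∈supp⇒∈terms p e∈)

∈terms⇒∈supp : ∀ {n} (p : Poly n) {e} → e ∈terms p → e ∈supp p
∈terms⇒∈supp ((c′ , e′) ∷ p) {e} (c , c≢0 , t∈) with ≡-dec ℕ._≟_ e′ e | t∈
... | yes _   | here refl = c≢0 ∘ ℕ.m+n≡0⇒m≡0 c
... | yes _   | there t∈p = ∈terms⇒∈supp p (c , c≢0 , t∈p) ∘ ℕ.m+n≡0⇒n≡0 c′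
... | no e′≢e | here refl = contradiction refl e′≢e
... | no _    | there t∈p = ∈terms⇒∈supp p (c , c≢0 , t∈p)

∈terms-*ₚ⁻ : ∀ {n} (p q : Poly n) {e} → e ∈terms (p *ₚ q) →
             ∃₂ λ e₁ e₂ → e₁ ∈terms p × e₂ ∈terms q × e ≡ e₁ ⊕ e₂
∈terms-*ₚ⁻ p q (c , c≢0 , t∈) with find (∈-concatMap⁻ _ {xs = p} t∈)
... | (c₁ , e₁) , t₁∈p , t∈row with ∈-map⁻ _ t∈row
... | (c₂ , e₂) , t₂∈q , refl =
  e₁ , e₂ , (c₁ , (λ { refl → c≢0 refl }) , t₁∈p)
          , (c₂ , (λ { refl → c≢0 (ℕ.*-zeroʳ c₁) }) , t₂∈q) , refl

∈terms-*ₚ⁺ : ∀ {n} (p q : Poly n) {e₁ e₂} → e₁ ∈terms p → e₂ ∈terms q → (e₁ ⊕ e₂) ∈terms (p *ₚ q)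
∈terms-*ₚ⁺ p q (c₁ , c₁≢0 , t₁∈p) (c₂ , c₂≢0 , t₂∈q) =
  c₁ * c₂ , [ c₁≢0 , c₂≢0 ]′ ∘ ℕ.m*n≡0⇒m≡0∨n≡0 c₁ , ∈-concatMap⁺ _ (lose t₁∈p (∈-map⁺ _ t₂∈q))

-- Interval sums

_∈[_⟩ : ∀ {n} → Fin n → Fin n × Fin n → Set
i ∈[ a , b ⟩ = a ≤ i × i < b

private
  from : ∀ {n} (a : Fin n) → Decidable {A = Fin n} (a ≤_)
  from a i = toℕ a ℕ.≤? toℕ i

  below : ∀ {n} (b : Fin n) → Decidable {A = Fin n} (_< b)
  below b i = toℕ i ℕ.<? toℕ b

_⊑_ : ∀ {n} → Fin n × Fin n → Fin n × Fin n → Set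
p ⊑ q = ∀ {i} → i ∈[ p ⟩ → i ∈[ q ⟩

∈terms-lin⁻ : ∀ {n} (a b : Fin n) {e} → e ∈terms lin a b → ∃[ i ] (i ∈[ a , b ⟩ × e ≡ unit i)
∈terms-lin⁻ {n} a b (_ , _ , t∈)
  with find (∈-concatMap⁻ var {xs = filter (from a) (filter (below b) (allFin n))} t∈)
... | i , i∈ , here refl with ∈-filter⁻ (from a) {xs = filter (below b) (allFin n)} i∈
... | i∈′ , a≤i = i , (a≤i , proj₂ (∈-filter⁻ (below b) {xs = allFin n} i∈′)) , refl

∈terms-lin⁺ : ∀ {n} {a b i : Fin n} → i ∈[ a , b ⟩ → unit i ∈terms lin a b
∈terms-lin⁺ {n} {i = i} (a≤i , i<b) =
  1 , (λ ()) , ∈-concatMap⁺ var (lose (∈-filter⁺ _ (∈-filter⁺ _ (∈-allFin i) i<b) a≤i) (here refl))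

linProd : ∀ {n} → List (Fin n × Fin n) → Poly n
linProd L = prodₚ (map (λ p → lin (proj₁ p) (proj₂ p)) L)

data Choice {n} : List (Fin n × Fin n) → Monomial n → Set where
  []   : Choice [] 0ᵐ
  pick : ∀ {p ps e} i → i ∈[ p ⟩ → Choice ps e → Choice (p ∷ ps) (unit i ⊕ e)

∈terms-linProd⇒Choice : ∀ {n} (L : List (Fin n × Fin n)) {e} → e ∈terms linProd L → Choice L e
∈terms-linProd⇒Choice []            (_ , _ , here refl) = []
∈terms-linProd⇒Choice ((a , b) ∷ L) e∈ with ∈terms-*ₚ⁻ (lin a b) (linProd L) e∈
... | _ , _ , e₁∈ , e₂∈ , refl with ∈terms-lin⁻ a b e₁∈
... | i , i∈ , refl = pick i i∈ (∈terms-linProd⇒Choice L e₂∈)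

Choice⇒∈terms-linProd : ∀ {n} {L : List (Fin n × Fin n)} {e} → Choice L e → e ∈terms linProd L
Choice⇒∈terms-linProd []             = 1 , (λ ()) , here refl
Choice⇒∈terms-linProd (pick i i∈ c) =
  ∈terms-*ₚ⁺ (lin _ _) _ (∈terms-lin⁺ i∈) (Choice⇒∈terms-linProd c)

Choice-resp-↭ : ∀ {n} {L M : List (Fin n × Fin n)} {e} → L ↭ M → Choice L e → Choice M e
Choice-resp-↭ ↭.refl             c             = c
Choice-resp-↭ (↭.prep _ L↭M)     (pick i i∈ c) = pick i i∈ (Choice-resp-↭ L↭M c)
Choice-resp-↭ (↭.swap _ _ L↭M)   (pick i i∈ (pick j j∈ c)) =
  subst (Choice _) (⊕.x∙yz≈y∙xz (unit j) (unit i) _) (pick j j∈ (pick i i∈ (Choice-resp-↭ L↭M c)))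
Choice-resp-↭ (↭.trans L↭K K↭M)  c             = Choice-resp-↭ K↭M (Choice-resp-↭ L↭K c)

Choice-map⁺ : ∀ {n} (f : Fin n × Fin n → Fin n × Fin n) {L e} →
              All (λ p → p ⊑ f p) L → Choice L e → Choice (map f L) e
Choice-map⁺ f All.[]           []            = []
Choice-map⁺ f (widen All.∷ ws) (pick i i∈ c) = pick i (widen i∈) (Choice-map⁺ f ws c)

-- Injective images of lists

InjectiveOn : ∀ {A B : Set} → (A → B) → List A → Set
InjectiveOn f xs = ∀ {x y} → x ∈ xs → y ∈ xs → f x ≡ f y → x ≡ y

∈-++-∷⁻ : ∀ {A : Set} {x y : A} as {bs} → y ∈ as ++ x ∷ bs → y ≢ x → y ∈ as ++ bs
∈-++-∷⁻ as y∈ y≢x with ∈-++⁻ as y∈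
... | inj₁ y∈as          = ∈-++⁺ˡ y∈as
... | inj₂ (here y≡x)    = contradiction y≡x y≢x
... | inj₂ (there y∈bs)  = ∈-++⁺ʳ as y∈bs

image-↭++ : ∀ {A B : Set} {f : A → B} {xs ys} → Unique xs → InjectiveOn f xs →
            (∀ {x} → x ∈ xs → f x ∈ ys) → ∃[ zs ] (ys ↭ map f xs ++ zs)
image-↭++ {xs = []} {ys} _ _ _ = ys , ↭.refl
image-↭++ {f = f} {x ∷ xs} (x∉xs ∷ xs!) inj img with ∈-∃++ (img (here refl))
... | as , bs , refl with image-↭++ xs! (λ y∈ z∈ → inj (there y∈) (there z∈)) img′
  where
  img′ : ∀ {y} → y ∈ xs → f y ∈ as ++ bs
  img′ y∈ = ∈-++-∷⁻ as (img (there y∈)) (All.lookup x∉xs y∈ ∘ sym ∘ inj (there y∈) (here refl))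
... | zs , as++bs↭ = zs , ↭.trans (shift (f x) as bs) (↭.prep (f x) as++bs↭)

length-↭-map++ : ∀ {A B : Set} (f : A → B) xs {ys zs} → ys ↭ map f xs ++ zs →
                 length ys ≡ length xs + length zs
length-↭-map++ f xs {ys} {zs} ys↭ = begin
  length ys                     ≡⟨ ↭-length ys↭ ⟩
  length (map f xs ++ zs)       ≡⟨ length-++ (map f xs) ⟩
  length (map f xs) + length zs ≡⟨ cong (_+ length zs) (length-map f xs) ⟩
  length xs + length zs         ∎
  where open ≡-Reasoning

module _ {A B : Set} {f : A → B} {xs ys} (xs! : Unique xs) (inj : InjectiveOn f xs)
         (img : ∀ {x} → x ∈ xs → f x ∈ ys) where

  length-image≤ : length xs ℕ.≤ length ys
  length-image≤ with image-↭++ xs! inj img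
  ... | zs , ys↭ = subst (length xs ℕ.≤_) (sym (length-↭-map++ f xs ys↭)) (ℕ.m≤m+n _ _)

  image-↭ : length ys ℕ.≤ length xs → ys ↭ map f xs
  image-↭ ys≤xs with image-↭++ xs! inj img
  ... | []    , ys↭ = subst (ys ↭_) (++-identityʳ (map f xs)) ys↭
  ... | _ ∷ _ , ys↭ =
    contradiction (subst (ℕ._≤ length xs) (length-↭-map++ f xs ys↭) ys≤xs)
                  (ℕ.m+1+n≰m (length xs))

IsInv : ∀ {n} → Perm n → Fin n × Fin n → Set
IsInv w (c , d) = c < d × w ⟨$⟩ʳ d < w ⟨$⟩ʳ c

concatMap-map-,≡cartesianProduct : ∀ {A B : Set} (xs : List A) (ys : List B) →
                                   concatMap (λ x → map (x ,_) ys) xs ≡ cartesianProduct xs ys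
concatMap-map-,≡cartesianProduct []       ys = refl
concatMap-map-,≡cartesianProduct (x ∷ xs) ys =
  cong (map (x ,_) ys ++_) (concatMap-map-,≡cartesianProduct xs ys)

private
  allPairs : ∀ n → List (Fin n × Fin n)
  allPairs n = concatMap (λ a → map (a ,_) (allFin n)) (allFin n)

  ascending? : ∀ {n} → Decidable {A = Fin n × Fin n} (λ p → proj₁ p < proj₂ p)
  ascending? p = proj₁ p <? proj₂ p

  inverted? : ∀ {n} (w : Perm n) →
              Decidable {A = Fin n × Fin n} (λ p → w ⟨$⟩ʳ proj₂ p < w ⟨$⟩ʳ proj₁ p)
  inverted? w p = w ⟨$⟩ʳ proj₂ p <? w ⟨$⟩ʳ proj₁ p

  ∈-allPairs : ∀ {n} (p : Fin n × Fin n) → p ∈ allPairs n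
  ∈-allPairs {n} (a , b) =
    subst ((a , b) ∈_) (sym (concatMap-map-,≡cartesianProduct (allFin n) (allFin n)))
          (∈-cartesianProduct⁺ (∈-allFin a) (∈-allFin b))

  allPairs-unique : ∀ n → Unique (allPairs n)
  allPairs-unique n = subst Unique (sym (concatMap-map-,≡cartesianProduct (allFin n) (allFin n)))
                        (Unique.cartesianProduct⁺ (Unique.allFin⁺ n) (Unique.allFin⁺ n))

∈Inv⁻ : ∀ {n} (w : Perm n) {p} → p ∈ Inv w → IsInv w p
∈Inv⁻ {n} w p∈ with ∈-filter⁻ (inverted? w) {xs = filter ascending? (allPairs n)} p∈
... | p∈′ , inverted = proj₂ (∈-filter⁻ ascending? {xs = allPairs n} p∈′) , inverted

∈Inv⁺ : ∀ {n} (w : Perm n) {p} → IsInv w p → p ∈ Inv w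
∈Inv⁺ w {p} (ascending , inverted) =
  ∈-filter⁺ (inverted? w) (∈-filter⁺ ascending? (∈-allPairs p) ascending) inverted

Inv-unique : ∀ {n} (w : Perm n) → Unique (Inv w)
Inv-unique {n} w = Unique.filter⁺ _ (Unique.filter⁺ _ (allPairs-unique n))

Inv-cong : ∀ {n} (u v : Perm n) → u ≈ v → Inv u ≡ Inv v
Inv-cong {n} u v u≈v = filter-≐ (inverted? u) (inverted? v)
  ((λ {p} → subst₂ _<_ (u≈v (proj₂ p)) (u≈v (proj₁ p))) ,
   (λ {p} → subst₂ _<_ (sym (u≈v (proj₂ p))) (sym (u≈v (proj₁ p)))))
  (filter ascending? (allPairs n))

Inv-id : ∀ {n} → Inv {n} id ≡ []
Inv-id {n} = filter-none (inverted? id)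
  (All.tabulate λ p∈ → <-asym (proj₂ (∈-filter⁻ ascending? {xs = allPairs n} p∈)))

transpose-matchˡ : ∀ {n} (i j : Fin n) → PC.transpose i j i ≡ j
transpose-matchˡ i j rewrite dec-true (i ≟ i) refl = refl

transpose-matchʳ : ∀ {n} (i j : Fin n) → PC.transpose i j j ≡ i
transpose-matchʳ i j with j ≟ i
... | yes j≡i = j≡i
... | no  _   rewrite dec-true (j ≟ j) refl = refl

transpose-other : ∀ {n} (i j : Fin n) {k} → k ≢ i → k ≢ j → PC.transpose i j k ≡ k
transpose-other i j {k} k≢i k≢j rewrite dec-false (k ≟ i) k≢i | dec-false (k ≟ j) k≢j = refl

transpose-involutive : ∀ {n} (i j k : Fin n) → PC.transpose i j (PC.transpose i j k) ≡ k
transpose-involutive i j k with toSum (k ≟ i) | toSum (k ≟ j)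
... | inj₁ refl | _         =
  trans (cong (PC.transpose i j) (transpose-matchˡ i j)) (transpose-matchʳ i j)
... | inj₂ _    | inj₁ refl =
  trans (cong (PC.transpose i j) (transpose-matchʳ i j)) (transpose-matchˡ i j)
... | inj₂ k≢i  | inj₂ k≢j  = trans (cong (PC.transpose i j) fixed) fixed
  where
  fixed : PC.transpose i j k ≡ k
  fixed = transpose-other i j k≢i k≢j

⟨$⟩ʳ-injective : ∀ {n} (π : Perm n) {x y} → π ⟨$⟩ʳ x ≡ π ⟨$⟩ʳ y → x ≡ y
⟨$⟩ʳ-injective π = Injection.injective (↔⇒↣ π)

·t-applyˡ : ∀ {n} (u : Perm n) a b → (u ·t[ a , b ]) ⟨$⟩ʳ a ≡ u ⟨$⟩ʳ b
·t-applyˡ u a b = cong (u ⟨$⟩ʳ_) (transpose-matchˡ a b)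

·t-applyʳ : ∀ {n} (u : Perm n) a b → (u ·t[ a , b ]) ⟨$⟩ʳ b ≡ u ⟨$⟩ʳ a
·t-applyʳ u a b = cong (u ⟨$⟩ʳ_) (transpose-matchʳ a b)

·t-apply-other : ∀ {n} (u : Perm n) a b {x} → x ≢ a → x ≢ b →
                 (u ·t[ a , b ]) ⟨$⟩ʳ x ≡ u ⟨$⟩ʳ x
·t-apply-other u a b x≢a x≢b = cong (u ⟨$⟩ʳ_) (transpose-other a b x≢a x≢b)

·t-involutive : ∀ {n} (u : Perm n) a b → (u ·t[ a , b ]) ·t[ a , b ] ≈ u
·t-involutive u a b = cong (u ⟨$⟩ʳ_) ∘ transpose-involutive a b

-- Inversions across u ⋖ u t_{ab}

module Cover {n} (u : Perm n) {a b : Fin n} (a<b : a < b) (ua<ub : u ⟨$⟩ʳ a < u ⟨$⟩ʳ b) where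

  private
    t : Fin n → Fin n
    t = PC.transpose a b

    w : Perm n
    w = u ·t[ a , b ]

    tt : Fin n × Fin n → Fin n × Fin n
    tt (c , d) = t c , t d

    tt-involutive : ∀ p → tt (tt p) ≡ p
    tt-involutive (c , d) = cong₂ _,_ (transpose-involutive a b c) (transpose-involutive a b d)

    w-a : w ⟨$⟩ʳ a ≡ u ⟨$⟩ʳ b
    w-a = ·t-applyˡ u a b

    w-b : w ⟨$⟩ʳ b ≡ u ⟨$⟩ʳ a
    w-b = ·t-applyʳ u a b

    w-other : ∀ {x} → x ≢ a → x ≢ b → w ⟨$⟩ʳ x ≡ u ⟨$⟩ʳ x
    w-other = ·t-apply-other u a b

    w≤u : ∀ {x} → x ≢ a → w ⟨$⟩ʳ x ≤ u ⟨$⟩ʳ x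
    w≤u {x} x≢a with toSum (x ≟ b)
    ... | inj₁ refl = ℕ.<⇒≤ (subst (_< u ⟨$⟩ʳ b) (sym w-b) ua<ub)
    ... | inj₂ x≢b  = ≤-reflexive (w-other x≢a x≢b)

    u≤w : ∀ {x} → x ≢ b → u ⟨$⟩ʳ x ≤ w ⟨$⟩ʳ x
    u≤w {x} x≢b with toSum (x ≟ a)
    ... | inj₁ refl = ℕ.<⇒≤ (subst (u ⟨$⟩ʳ a <_) (sym w-a) ua<ub)
    ... | inj₂ x≢a  = ≤-reflexive (sym (w-other x≢a x≢b))

    u-≮⇒< : ∀ {x y} → x ≢ y → ¬ u ⟨$⟩ʳ y < u ⟨$⟩ʳ x → u ⟨$⟩ʳ x < u ⟨$⟩ʳ y
    u-≮⇒< x≢y uy≮ux = ≤∧≢⇒< (ℕ.≮⇒≥ uy≮ux) (x≢y ∘ ⟨$⟩ʳ-injective u)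

  L₀ : List (Fin n × Fin n)
  L₀ = (a , b) ∷ Inv u

  L₀-unique : Unique L₀
  L₀-unique = All.tabulate (λ { ab∈ refl → <-asym ua<ub (proj₂ (∈Inv⁻ u ab∈)) }) ∷ Inv-unique u

  φ : Fin n × Fin n → Fin n × Fin n
  φ (c , d) = if does (w ⟨$⟩ʳ d <? w ⟨$⟩ʳ c) then (c , d) else tt (c , d)

  φ-stays : ∀ {c d} → w ⟨$⟩ʳ d < w ⟨$⟩ʳ c → φ (c , d) ≡ (c , d)
  φ-stays {c} {d} wd<wc rewrite dec-true (w ⟨$⟩ʳ d <? w ⟨$⟩ʳ c) wd<wc = refl

  φ-moves : ∀ {c d} → ¬ w ⟨$⟩ʳ d < w ⟨$⟩ʳ c → φ (c , d) ≡ tt (c , d)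
  φ-moves {c} {d} wd≮wc rewrite dec-false (w ⟨$⟩ʳ d <? w ⟨$⟩ʳ c) wd≮wc = refl

  data Fate (p : Fin n × Fin n) : Set where
    stays : φ p ≡ p → IsInv w p → Fate p
    moves : ∀ {q} → φ p ≡ tt p → tt p ≡ q → q ∉ L₀ → IsInv w q → p ⊑ q → Fate p

  private
    moved : ∀ {c d} → (c , d) ∈ L₀ → ¬ w ⟨$⟩ʳ d < w ⟨$⟩ʳ c → Fate (c , d)
    moved (here refl) wb≮wa = contradiction (subst₂ _<_ (sym w-b) (sym w-a) ua<ub) wb≮wa
    moved {c} {d} (there p∈) wd≮wc with ∈Inv⁻ u p∈ | toSum (c ≟ b) | toSum (d ≟ a)
    ... | b<d , ud<ub | inj₁ refl | _ =
      moves (φ-moves wd≮wc) (cong₂ _,_ (transpose-matchʳ a b) td≡d)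
            ad∉L₀ (<-trans a<b b<d , subst₂ _<_ (sym wd≡ud) (sym w-a) ud<ub)
            (λ (b≤i , i<d) → ℕ.≤-trans (ℕ.<⇒≤ a<b) b≤i , i<d)
      where
      d≢a : d ≢ a
      d≢a refl = <-asym a<b b<d
      d≢b : d ≢ b
      d≢b refl = <-irrefl refl b<d
      td≡d : t d ≡ d
      td≡d = transpose-other a b d≢a d≢b
      wd≡ud : w ⟨$⟩ʳ d ≡ u ⟨$⟩ʳ d
      wd≡ud = w-other d≢a d≢b
      ad∉L₀ : (a , d) ∉ L₀
      ad∉L₀ (here refl) = <-irrefl refl b<d
      ad∉L₀ (there ad∈) = <-asym (proj₂ (∈Inv⁻ u ad∈))
                                 (u-≮⇒< (d≢a ∘ sym) (subst₂ (λ x y → ¬ x < y) wd≡ud w-b wd≮wc))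
    ... | c<a , ua<uc | inj₂ c≢b | inj₁ refl =
      moves (φ-moves wd≮wc) (cong₂ _,_ tc≡c (transpose-matchˡ a b))
            cb∉L₀ (<-trans c<a a<b , subst₂ _<_ (sym w-b) (sym wc≡uc) ua<uc)
            (λ (c≤i , i<a) → c≤i , ℕ.<-trans i<a a<b)
      where
      c≢a : c ≢ a
      c≢a refl = <-irrefl refl c<a
      tc≡c : t c ≡ c
      tc≡c = transpose-other a b c≢a c≢b
      wc≡uc : w ⟨$⟩ʳ c ≡ u ⟨$⟩ʳ c
      wc≡uc = w-other c≢a c≢b
      cb∉L₀ : (c , b) ∉ L₀
      cb∉L₀ (here refl) = <-irrefl refl c<a
      cb∉L₀ (there cb∈) = <-asym (proj₂ (∈Inv⁻ u cb∈))
                                 (u-≮⇒< c≢b (subst₂ (λ x y → ¬ x < y) w-a wc≡uc wd≮wc))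
    ... | _ , ud<uc | inj₂ c≢b | inj₂ d≢a =
      contradiction (ℕ.≤-<-trans (w≤u d≢a) (ℕ.<-≤-trans ud<uc (u≤w c≢b))) wd≮wc

  fate : ∀ {p} → p ∈ L₀ → Fate p
  fate {c , d} p∈ with w ⟨$⟩ʳ d <? w ⟨$⟩ʳ c
  ... | yes wd<wc = stays (φ-stays wd<wc) (ascending p∈ , wd<wc)
    where
    ascending : (c , d) ∈ L₀ → c < d
    ascending (here refl) = a<b
    ascending (there p∈′) = proj₁ (∈Inv⁻ u p∈′)
  ... | no wd≮wc  = moved p∈ wd≮wc

  φ-∈Inv : ∀ {p} → p ∈ L₀ → φ p ∈ Inv w
  φ-∈Inv {p} p∈ with fate p∈
  ... | stays φp≡p inv              = ∈Inv⁺ w (subst (IsInv w) (sym φp≡p) inv)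
  ... | moves φp≡ttp ttp≡q _ inv _  = ∈Inv⁺ w (subst (IsInv w) (sym (trans φp≡ttp ttp≡q)) inv)

  φ-widens : ∀ {p} → p ∈ L₀ → p ⊑ φ p
  φ-widens p∈ {i} with fate p∈
  ... | stays φp≡p _                = subst (i ∈[_⟩) (sym φp≡p)
  ... | moves φp≡ttp ttp≡q _ _ p⊑q  = subst (i ∈[_⟩) (sym (trans φp≡ttp ttp≡q)) ∘ p⊑q

  φ-injectiveOn : InjectiveOn φ L₀
  φ-injectiveOn {p} {q} p∈ q∈ φp≡φq with fate p∈ | fate q∈
  ... | stays φp≡p _ | stays φq≡q _ = begin
    p   ≡⟨ φp≡p ⟨
    φ p ≡⟨ φp≡φq ⟩
    φ q ≡⟨ φq≡q ⟩
    q   ∎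
    where open ≡-Reasoning
  ... | stays φp≡p _ | moves φq≡ttq ttq≡q′ q′∉L₀ _ _ =
    contradiction (subst (_∈ L₀) (trans (sym φp≡p) (trans φp≡φq (trans φq≡ttq ttq≡q′))) p∈)
                  q′∉L₀
  ... | moves φp≡ttp ttp≡p′ p′∉L₀ _ _ | stays φq≡q _ =
    contradiction (subst (_∈ L₀) (trans (sym φq≡q) (trans (sym φp≡φq) (trans φp≡ttp ttp≡p′))) q∈)
                  p′∉L₀
  ... | moves φp≡ttp _ _ _ _ | moves φq≡ttq _ _ _ _ = begin
    p           ≡⟨ tt-involutive p ⟨
    tt (tt p)   ≡⟨ cong tt φp≡ttp ⟨
    tt (φ p)    ≡⟨ cong tt φp≡φq ⟩
    tt (φ q)    ≡⟨ cong tt φq≡ttq ⟩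
    tt (tt q)   ≡⟨ tt-involutive q ⟩
    q           ∎
    where open ≡-Reasoning

ℓ-·t-ascent : ∀ {n} (u : Perm n) {a b} → a < b → u ⟨$⟩ʳ a < u ⟨$⟩ʳ b → ℓ u ℕ.< ℓ (u ·t[ a , b ])
ℓ-·t-ascent u a<b ua<ub = length-image≤ L₀-unique φ-injectiveOn φ-∈Inv
  where open Cover u a<b ua<ub

cover⇒ascent : ∀ {n} (u : Perm n) {a b} → a < b → ℓ (u ·t[ a , b ]) ≡ suc (ℓ u) →
               u ⟨$⟩ʳ a < u ⟨$⟩ʳ b
cover⇒ascent {n} u {a} {b} a<b ℓ≡ with <-cmp (u ⟨$⟩ʳ a) (u ⟨$⟩ʳ b)
... | tri< ua<ub _ _ = ua<ub
... | tri≈ _ ua≡ub _ = contradiction (⟨$⟩ʳ-injective u ua≡ub) (<⇒≢ a<b)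
... | tri> _ _ ub<ua = contradiction ℓ-descent (ℕ.<-asym (ℕ.n<1+n (ℓ u)))
  where
  w : Perm n
  w = u ·t[ a , b ]

  ℓ-descent : suc (ℓ u) ℕ.< ℓ u
  ℓ-descent = begin-strict
    suc (ℓ u)         ≡⟨ ℓ≡ ⟨
    ℓ w               <⟨ ℓ-·t-ascent w a<b wa<wb ⟩
    ℓ (w ·t[ a , b ]) ≡⟨ cong length (Inv-cong (w ·t[ a , b ]) u (·t-involutive u a b)) ⟩
    ℓ u               ∎
    where
    open ℕ.≤-Reasoning
    wa<wb : w ⟨$⟩ʳ a < w ⟨$⟩ʳ b
    wa<wb = subst₂ _<_ (sym (·t-applyˡ u a b)) (sym (·t-applyʳ u a b)) ub<ua

Choice-cover : ∀ {n} (u : Perm n) {a b e} → a < b → ℓ (u ·t[ a , b ]) ≡ suc (ℓ u) →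
               Choice ((a , b) ∷ Inv u) e → Choice (Inv (u ·t[ a , b ])) e
Choice-cover u a<b ℓ≡ c =
  Choice-resp-↭ (↭-sym (image-↭ L₀-unique φ-injectiveOn φ-∈Inv (ℕ.≤-reflexive ℓ≡)))
                (Choice-map⁺ φ (All.tabulate φ-widens) c)
  where open Cover u a<b (cover⇒ascent u a<b ℓ≡)

edges : ∀ {n} {u v : Perm n} → SatChain u v → List (Fin n × Fin n)
edges (done _)           = []
edges (step a b _ _ C)   = (a , b) ∷ edges C

weight≡linProd : ∀ {n} {u v : Perm n} (C : SatChain u v) → weight C ≡ linProd (edges C)
weight≡linProd (done _)         = refl
weight≡linProd (step a b _ _ C) = cong (lin a b *ₚ_) (weight≡linProd C)

Choice-chain : ∀ {n} {u v : Perm n} (C : SatChain u v) {e₁ e₂} →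
               Choice (Inv u) e₁ → Choice (edges C) e₂ → Choice (Inv v) (e₁ ⊕ e₂)
Choice-chain {u = u} {v} (done u≈v) c₁ [] =
  subst₂ Choice (Inv-cong u v u≈v) (sym (⊕-identityʳ _)) c₁
Choice-chain {u = u} (step a b a<b ℓ≡ C) {e₁} c₁ (pick i i∈ c₂) =
  subst (Choice _) (⊕.xy∙z≈y∙xz (unit i) e₁ _)
        (Choice-chain C (Choice-cover u a<b ℓ≡ (pick i i∈ c₁)) c₂)

lemma3p15 : (n : ℕ) (w : Perm n) (C : SatChain id w) → weight C ⊆supp GW w
lemma3p15 n w C e e∈weight = ∈terms⇒∈supp (GW w) (Choice⇒∈terms-linProd GW-choice)
  where
  C-choice : Choice (edges C) e
  C-choice = ∈terms-linProd⇒Choice (edges C)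
               (subst (e ∈terms_) (weight≡linProd C) (∈supp⇒∈terms (weight C) e∈weight))

  GW-choice : Choice (Inv w) e
  GW-choice = subst (Choice (Inv w)) (⊕-identityˡ e)
                (Choice-chain C (subst (λ L → Choice L 0ᵐ) (sym Inv-id) []) C-choice)
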